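{- Let $S=(s_1,\dots,s_{kn})$ be a read-$k$ sequence over $X=\{x_1,\dots,x_n\}$ which is per-read-monotone and $k$-regularly-interleaving. Consider a Turing machine tape with cells $1,\dots,n$, cell $i$ holding $x_i$, and a head that reads $s_1,s_2,\dots,s_{kn}$ in order, moving one cell at a time; so cell $i$ is visited once for each $\ell$ with $s_\ell=x_i$ and once for each $\ell<kn$ such that $i$ lies strictly between the indices of $s_\ell$ and $s_{\ell+1}$. Then every cell is visited at most $2k$ times.
   Context: A sequence $S\in X^{m}$ is a read-$k$ sequence over $X$ if every element of $X$ appears exactly $k$ times (so $m=kn$). For $i\in[k]$, $S^{(i)}$ denotes the subsequence of $S$ consisting of the $i$-th occurrences of the elements (a permutation of $X$); for $i\ne j$, $S^{(i,j)}$ is the subsequence consisting of the $i$-th and $j$-th occurrences of all elements. Variables are indexed so that $S^{(1)}=(x_1,\dots,x_n)$, and $X$ is ordered by $x_1<x_2<\dots<x_n$. $S$ is per-read-monotone if for every $i\in[k]$, $S^{(i)}$ is monotonically increasing or monotonically decreasing in this order. A read-2 sequence $S$ over $X$ is 2-regularly-interleaving if there is a partition $X=X_1\sqcup\dots\sqcup X_t$ such that $S$ is the concatenation $(S_1,\dots,S_t)$ where each $S_i$ is a read-2 sequence over $X_i$, and each $S_i$ is the concatenation of $S_{i,1}$ and $S_{i,2}$, where $S_{i,c}$ consists of the $c$-th occurrences of the elements of $X_i$ (for $c=1,2$). A read-$k$ sequence is $k$-regularly-interleaving if for all $i\ne j\in[k]$, the subsequence $S^{(i,j)}$ (viewed as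 a read-2 sequence) is 2-regularly-interleaving. -}

module Defs where

open import Data.Nat using (ℕ; zero; suc; _+_; _*_; _≤_; _≡ᵇ_; _<ᵇ_)
open import Data.Empty using (⊥)
open import Data.Bool using (Bool; true; false; if_then_else_; _∧_; _∨_)
open import Data.Fin using (Fin; toℕ)
open import Data.List using (List; []; _∷_; _++_; map; length; filterᵇ; concat; allFin)
open import Data.List.Relation.Unary.All using (All)
open import Data.List.Relation.Unary.Unique.Propositional using (Unique)
open import Data.List.Relation.Unary.Linked using (Linked)
open import Data.List.Relation.Binary.Permutation.Propositional using (_↭_)
open import Data.Product using (_×_; _,_; proj₁; proj₂; ∃)
open import Data.Sum using (_⊎_)
open import Relation.Binary.PropositionalEquality using (_≡_)
import Data.Fin as F

-- X = {x_1,...,x_n} is represented by Fin n, element x_{i+1} ↔ (i : Fin n),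
-- ordered by the order of Fin.  Sequences are lists over Fin n.

_==_ : ∀ {n} → Fin n → Fin n → Bool
a == b = toℕ a ≡ᵇ toℕ b

count : ∀ {n} → Fin n → List (Fin n) → ℕ
count x S = length (filterᵇ (λ y → y == x) S)

ReadK : ∀ {n} → ℕ → List (Fin n) → Set
ReadK {n} k S = (x : Fin n) → count x S ≡ k

-- annotate every position with its occurrence number (1-based):
-- the ℓ-th entry is (s_ℓ , r) where s_ℓ is the r-th occurrence of s_ℓ in S
annot : ∀ {n} → List (Fin n) → List (Fin n × ℕ)
annot [] = []
annot (x ∷ xs) = (x , 1) ∷ map (λ p → (proj₁ p , (if proj₁ p == x then suc (proj₂ p) else proj₂ p))) (annot xs)

readSub : ∀ {n} → ℕ → List (Fin n) → List (Fin n)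
readSub i S = map proj₁ (filterᵇ (λ p → proj₂ p ≡ᵇ i) (annot S))

readSub2 : ∀ {n} → ℕ → ℕ → List (Fin n) → List (Fin n)
readSub2 i j S = map proj₁ (filterᵇ (λ p → (proj₂ p ≡ᵇ i) ∨ (proj₂ p ≡ᵇ j)) (annot S))

IndexedByFirstRead : ∀ {n} → List (Fin n) → Set
IndexedByFirstRead {n} S = readSub 1 S ≡ allFin n

PerReadMonotone : ∀ {n} → ℕ → List (Fin n) → Set
PerReadMonotone k S = (i : ℕ) → 1 ≤ i → i ≤ k →
  Linked F._<_ (readSub i S) ⊎ Linked F._>_ (readSub i S)

-- 2-regularly-interleaving (for a read-2 sequence T): T is a concatenation of
-- blocks S_i = S_{i,1} ++ S_{i,2}, where S_{i,1} lists the first occurrences of the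
-- elements of X_i (each once) and S_{i,2} lists their second occurrences (each once).
-- Since T is read-2, the sets X_i are automatically disjoint and cover X.
RegInterleaving2 : ∀ {n} → List (Fin n) → Set
RegInterleaving2 {n} T =
  ∃ λ (blocks : List (List (Fin n) × List (Fin n))) →
    (T ≡ concat (map (λ b → proj₁ b ++ proj₂ b) blocks)) ×
    All (λ b → Unique (proj₁ b) × (proj₂ b ↭ proj₁ b)) blocks

RegInterleavingK : ∀ {n} → ℕ → List (Fin n) → Set
RegInterleavingK k S = (i j : ℕ) → 1 ≤ i → i ≤ k → 1 ≤ j → j ≤ k → (i ≡ j → ⊥) →
  RegInterleaving2 (readSub2 i j S)

between : ∀ {n} → Fin n → Fin n → Fin n → Bool
between c a b = ((toℕ a <ᵇ toℕ c) ∧ (toℕ c <ᵇ toℕ b))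
              ∨ ((toℕ b <ᵇ toℕ c) ∧ (toℕ c <ᵇ toℕ a))

passes : ∀ {n} → Fin n → List (Fin n) → ℕ
passes c [] = 0
passes c (a ∷ []) = 0
passes c (a ∷ b ∷ rest) = (if between c a b then 1 else 0) + passes c (b ∷ rest)

visits : ∀ {n} → Fin n → List (Fin n) → ℕ
visits c S = count c S + passes c S

-- Fix the cell c. For a position p of S write R(p) for the number of reads of c among
-- s₀,…,s_p, and ι(p) for the round of s_p (s_p is the ι(p)-th occurrence of its element).
-- The phase Φ(p) = R(p) + [R(p) < ι(p)] never exceeds k, never decreases, and increases
-- whenever the head passes over c between s_p and s_{p+1}.  Indeed, a pass while ι(p) and
-- ι(p+1) lie on the same side of R(p) contradicts the monotonicity of read R(p) or R(p)+1,
-- and a descent ι(p+1) ≤ R(p) < ι(p) would nest the ι(p)-th occurrence of s_p and the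
-- ι(p+1)-th occurrence of s_{p+1} between two reads of c, which regular interleaving of the
-- reads ι(p+1) and ι(p) forbids.  So c is passed at most k times and read exactly k times.
module Submission where

open import Defs
open import Data.Bool using (Bool; true; false; T; if_then_else_; _∨_)
open import Data.Bool.Properties using (T-∧; T-∨)
open import Data.Empty using (⊥; ⊥-elim)
open import Data.Fin using (Fin; toℕ)
import Data.Fin as Fin
import Data.Fin.Properties as Fin
open import Data.List using (List; []; _∷_; _++_; map; length; filterᵇ; concat; take)
open import Data.List.Properties using (length-++; length-map; ++-assoc; take-all)
open import Data.List.Membership.Propositional using (_∈_)
open import Data.List.Membership.Propositional.Properties using (∈-++⁻)
import Data.List.Relation.Unary.Any as Any
open import Data.List.Relation.Unary.All as All using (All; _∷_)
open import Data.List.Relation.Unary.Linked using (Linked; _∷_; [-])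
open import Data.List.Relation.Binary.Permutation.Propositional using (_↭_; ↭-sym)
open import Data.List.Relation.Binary.Permutation.Propositional.Properties using (∈-resp-↭)
open import Data.Nat using (ℕ; zero; suc; _+_; _*_; _≤_; _<_; z≤n; s≤s; _⊔_; _≡ᵇ_; _≤?_; _<?_)
open import Data.Nat.Properties
open import Data.Product using (∃; ∃₂; _×_; _,_; proj₁; proj₂)
open import Data.Sum using (_⊎_; inj₁; inj₂)
open import Function using (_∘_; flip; Equivalence)
open import Relation.Binary.Definitions using (Transitive; tri<; tri≈; tri>)
open import Relation.Nullary using (¬_; yes; no; contradiction)
open import Relation.Binary.PropositionalEquality

-- Positions in lists

infix 4 _[_]=_

data _[_]=_ {A : Set} : List A → ℕ → A → Set where
  here  : ∀ {x xs} → (x ∷ xs) [ 0 ]= x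
  there : ∀ {y x xs p} → xs [ p ]= x → (y ∷ xs) [ suc p ]= x

module _ {A : Set} where

  at-unique : ∀ {L : List A} {p x y} → L [ p ]= x → L [ p ]= y → x ≡ y
  at-unique here      here      = refl
  at-unique (there a) (there b) = at-unique a b

  at-< : ∀ {L : List A} {p x} → L [ p ]= x → p < length L
  at-< here      = s≤s z≤n
  at-< (there a) = s≤s (at-< a)

  at-exists : ∀ (L : List A) {p} → p < length L → ∃ λ x → L [ p ]= x
  at-exists (x ∷ L) {zero}  _        = x , here
  at-exists (x ∷ L) {suc p} (s≤s p<) = let (y , a) = at-exists L p< in y , there a

  at⇒∈ : ∀ {L : List A} {p x} → L [ p ]= x → x ∈ L
  at⇒∈ here      = Any.here refl
  at⇒∈ (there a) = Any.there (at⇒∈ a)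

  ∈⇒at : ∀ {L : List A} {x} → x ∈ L → ∃ λ p → L [ p ]= x
  ∈⇒at (Any.here refl) = 0 , here
  ∈⇒at (Any.there x∈)  = let (p , a) = ∈⇒at x∈ in suc p , there a

  at-++ˡ : ∀ {L : List A} {p x} M → L [ p ]= x → (L ++ M) [ p ]= x
  at-++ˡ M here      = here
  at-++ˡ M (there a) = there (at-++ˡ M a)

  at-++ʳ : ∀ (L : List A) {M p x} → M [ p ]= x → (L ++ M) [ length L + p ]= x
  at-++ʳ []      a = a
  at-++ʳ (y ∷ L) a = there (at-++ʳ L a)

  at-++⁻ : ∀ (L : List A) {M p x} → (L ++ M) [ p ]= x →
           L [ p ]= x ⊎ ∃ λ q → p ≡ length L + q × M [ q ]= x
  at-++⁻ []      a         = inj₂ (_ , refl , a)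
  at-++⁻ (y ∷ L) here      = inj₁ here
  at-++⁻ (y ∷ L) (there a) with at-++⁻ L a
  ... | inj₁ b              = inj₁ (there b)
  ... | inj₂ (q , refl , b) = inj₂ (q , refl , b)

  at-middle : ∀ (L M : List A) {N p x} → (L ++ M ++ N) [ p ]= x →
              length L ≤ p → p < length L + length M →
              ∃ λ q → p ≡ length L + q × M [ q ]= x
  at-middle L M a L≤p p<LM with at-++⁻ L a
  ... | inj₁ b = ⊥-elim (<⇒≱ (at-< b) L≤p)
  ... | inj₂ (q , refl , b) with at-++⁻ M b
  ...   | inj₁ c               = q , refl , c
  ...   | inj₂ (q′ , refl , _) =
          ⊥-elim (<⇒≱ (+-cancelˡ-< (length L) _ _ p<LM) (m≤m+n (length M) q′))

  linked-at : ∀ {R : A → A → Set} → Transitive R →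
              ∀ {L a b u v} → Linked R L → L [ a ]= u → L [ b ]= v → a < b → R u v
  linked-at trans (r ∷ l) here      (there here)      _         = r
  linked-at trans (r ∷ l) here      (there (there b)) _         =
    trans r (linked-at trans l here (there b) (s≤s z≤n))
  linked-at trans (r ∷ l) (there a) (there b)         (s≤s a<b) = linked-at trans l a b a<b
  linked-at trans [-]     here      (there ())        _
  linked-at trans [-]     (there ()) _                _

at-map : ∀ {A B : Set} (f : A → B) {L p x} → L [ p ]= x → map f L [ p ]= f x
at-map f here      = here
at-map f (there a) = there (at-map f a)

at-map⁻ : ∀ {A B : Set} (f : A → B) {L p y} → map f L [ p ]= y →
          ∃ λ x → L [ p ]= x × f x ≡ y
at-map⁻ f {x ∷ L} here      = x , here , refl
at-map⁻ f {x ∷ L} (there a) = let (z , b , e) = at-map⁻ f a in z , there b , e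

module _ {A : Set} (P : A → Bool) where

  rank : List A → ℕ → ℕ
  rank L p = length (filterᵇ P (take p L))

  rank-hit : ∀ {L p x} → L [ p ]= x → T (P x) → rank L (suc p) ≡ suc (rank L p)
  rank-hit (here {x}) Px with P x | Px
  ... | true | _ = refl
  rank-hit (there {y} a) Px with P y
  ... | true  = cong suc (rank-hit a Px)
  ... | false = rank-hit a Px

  rank-miss : ∀ {L p x} → L [ p ]= x → ¬ T (P x) → rank L (suc p) ≡ rank L p
  rank-miss (here {x}) ¬Px with P x | ¬Px
  ... | true  | ¬Px = ⊥-elim (¬Px _)
  ... | false | _   = refl
  rank-miss (there {y} a) ¬Px with P y
  ... | true  = cong suc (rank-miss a ¬Px)
  ... | false = rank-miss a ¬Px

  rank-mono : ∀ L {p q} → p ≤ q → rank L p ≤ rank L q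
  rank-mono []      {zero}  {_}     _         = z≤n
  rank-mono []      {suc p} {suc q} _         = z≤n
  rank-mono (x ∷ L) {zero}  {_}     _         = z≤n
  rank-mono (x ∷ L) {suc p} {suc q} (s≤s p≤q) with P x
  ... | true  = s≤s (rank-mono L p≤q)
  ... | false = rank-mono L p≤q

  rank-≤ : ∀ L p → rank L p ≤ length (filterᵇ P L)
  rank-≤ L p =
    subst (rank L p ≤_) (cong (length ∘ filterᵇ P) (take-all (p ⊔ length L) L (m≤n⊔m p _)))
          (rank-mono L (m≤m⊔n p (length L)))

  rank-strict : ∀ {L p q x} → L [ p ]= x → T (P x) → p < q → rank L p < rank L q
  rank-strict {L} a Px p<q = subst (_≤ _) (rank-hit a Px) (rank-mono L p<q)

  rank-∷-accept : ∀ {y} L p → T (P y) → rank (y ∷ L) (suc p) ≡ suc (rank L p)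
  rank-∷-accept {y} L p Py with P y | Py
  ... | true | _ = refl

  rank-∷-reject : ∀ {y} L p → ¬ T (P y) → rank (y ∷ L) (suc p) ≡ rank L p
  rank-∷-reject {y} L p ¬Py with P y | ¬Py
  ... | true  | ¬Py = ⊥-elim (¬Py _)
  ... | false | _   = refl

  filter-at : ∀ {L p x} → L [ p ]= x → T (P x) → filterᵇ P L [ rank L p ]= x
  filter-at (here {x}) Px with P x | Px
  ... | true | _ = here
  filter-at (there {y} a) Px with P y
  ... | true  = there (filter-at a Px)
  ... | false = filter-at a Px

  filter-at⁻ : ∀ {L a x} → filterᵇ P L [ a ]= x → ∃ λ p → L [ p ]= x × T (P x) × rank L p ≡ a
  filter-at⁻ {y ∷ L} b with P y in Py
  filter-at⁻ {y ∷ L} here      | true = 0 , here , subst T (sym Py) _ , refl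
  filter-at⁻ {y ∷ L} (there b) | true =
    let (p , a , Px , p↦a) = filter-at⁻ {L} b
    in suc p , there a , Px , trans (rank-∷-accept L p (subst T (sym Py) _)) (cong suc p↦a)
  ... | false =
    let (p , a , Px , p↦a) = filter-at⁻ {L} b
    in suc p , there a , Px , trans (rank-∷-reject L p (subst T Py)) p↦a

-- Sequences made of blocks

module _ {A : Set} where

  AtMostTwice : List A → Set
  AtMostTwice L = ∀ {x p q r} → p < q → q < r → L [ p ]= x → L [ q ]= x → L [ r ]= x → ⊥

  occurrence-pair-unique : ∀ {L : List A} → AtMostTwice L →
    ∀ {x q₁ q₂ u v} → q₁ < q₂ → L [ q₁ ]= x → L [ q₂ ]= x →
    u < v → L [ u ]= x → L [ v ]= x → u ≡ q₁ × v ≡ q₂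
  occurrence-pair-unique twice {q₁ = q₁} {q₂} {u} {v} q₁<q₂ a₁ a₂ u<v aᵤ aᵥ = u≡q₁ , v≡q₂
    where
    u≡q₁ : u ≡ q₁
    u≡q₁ with <-cmp u q₁
    ... | tri< u<q₁ _ _ = ⊥-elim (twice u<q₁ q₁<q₂ aᵤ a₁ a₂)
    ... | tri≈ _ u≡q₁ _ = u≡q₁
    ... | tri> _ _ q₁<u with <-cmp u q₂
    ...   | tri< u<q₂ _ _ = ⊥-elim (twice q₁<u u<q₂ a₁ aᵤ a₂)
    ...   | tri≈ _ refl _ = ⊥-elim (twice q₁<q₂ u<v a₁ a₂ aᵥ)
    ...   | tri> _ _ q₂<u = ⊥-elim (twice q₁<q₂ q₂<u a₁ a₂ aᵤ)
    v≡q₂ : v ≡ q₂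
    v≡q₂ with <-cmp v q₂
    ... | tri< v<q₂ _ _ = ⊥-elim (twice (subst (_< v) u≡q₁ u<v) v<q₂ a₁ aᵥ a₂)
    ... | tri≈ _ v≡q₂ _ = v≡q₂
    ... | tri> _ _ q₂<v = ⊥-elim (twice q₁<q₂ q₂<v a₁ a₂ aᵥ)

  flatten : List (List A × List A) → List A
  flatten bs = concat (map (λ b → proj₁ b ++ proj₂ b) bs)

  record Block (L : List A) : Set where
    constructor block
    field
      prefix first second suffix : List A
      second↭first : second ↭ first
      split : L ≡ prefix ++ (first ++ second) ++ suffix

    start mid end : ℕ
    start = length prefix
    mid   = length prefix + length first
    end   = length prefix + length (first ++ second)

  open Block

  block-containing : ∀ bs → All (λ b → proj₂ b ↭ proj₁ b) bs →
    ∀ {a x} → flatten bs [ a ]= x → ∃ λ (B : Block (flatten bs)) → start B ≤ a × a < end B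
  block-containing ((f , g) ∷ bs) (g↭f ∷ perms) a with at-++⁻ (f ++ g) a
  ... | inj₁ inB = block [] f g (flatten bs) g↭f refl , z≤n , at-< inB
  ... | inj₂ (q , refl , rest) with block-containing bs perms rest
  ...   | block P f′ g′ T′ g′↭f′ split′ , P≤q , q<end =
          block ((f ++ g) ++ P) f′ g′ T′ g′↭f′
                (trans (cong ((f ++ g) ++_) split′) (sym (++-assoc (f ++ g) P _))) ,
          subst (_≤ length (f ++ g) + q) (sym |fg++P|) (+-monoʳ-≤ (length (f ++ g)) P≤q) ,
          subst (length (f ++ g) + q <_)
                (sym (trans (cong (_+ length (f′ ++ g′)) |fg++P|) (+-assoc (length (f ++ g)) (length P) _)))
                (+-monoʳ-< (length (f ++ g)) q<end)
    where
    |fg++P| : length ((f ++ g) ++ P) ≡ length (f ++ g) + length P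
    |fg++P| = length-++ (f ++ g)

  ∈-both-halves : ∀ {f g : List A} {w} → g ↭ f → w ∈ f ++ g → w ∈ f × w ∈ g
  ∈-both-halves {f} g↭f w∈fg with ∈-++⁻ f w∈fg
  ... | inj₁ w∈f = w∈f , ∈-resp-↭ (↭-sym g↭f) w∈f
  ... | inj₂ w∈g = ∈-resp-↭ g↭f w∈g , w∈g

  in-both-halves : ∀ {L : List A} (B : Block L) → ∀ {p w} → L [ p ]= w → start B ≤ p → p < end B →
    ∃₂ λ q₁ q₂ → L [ q₁ ]= w × L [ q₂ ]= w × q₁ < mid B × mid B ≤ q₂ × q₂ < end B
  in-both-halves (block P f g T′ g↭f refl) a P≤p p<end
    with at-middle P (f ++ g) a P≤p p<end
  ... | _ , _ , inB with ∈-both-halves g↭f (at⇒∈ inB)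
  ... | w∈f , w∈g with ∈⇒at w∈f | ∈⇒at w∈g
  ... | q₁ , a₁ | q₂ , a₂ =
    length P + q₁ , length P + (length f + q₂) ,
    at-++ʳ P (at-++ˡ T′ (at-++ˡ g a₁)) , at-++ʳ P (at-++ˡ T′ (at-++ʳ f a₂)) ,
    +-monoʳ-< (length P) (at-< a₁) ,
    +-monoʳ-≤ (length P) (m≤m+n (length f) q₂) ,
    +-monoʳ-< (length P) (subst (length f + q₂ <_) (sym (length-++ f)) (+-monoʳ-< (length f) (at-< a₂)))

  occurrences-in-block : ∀ {L : List A} → AtMostTwice L → (B : Block L) →
    ∀ {p u v w} → L [ p ]= w → start B ≤ p → p < end B →
    u < v → L [ u ]= w → L [ v ]= w → u < mid B × mid B ≤ v × v < end B
  occurrences-in-block twice B a s≤p p<e u<v aᵤ aᵥ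
    with in-both-halves B a s≤p p<e
  ... | q₁ , q₂ , a₁ , a₂ , q₁<m , m≤q₂ , q₂<e
    with occurrence-pair-unique twice (<-≤-trans q₁<m m≤q₂) a₁ a₂ u<v aᵤ aᵥ
  ... | refl , refl = q₁<m , m≤q₂ , q₂<e

  flatten-¬nested : ∀ bs → All (λ b → proj₂ b ↭ proj₁ b) bs → AtMostTwice (flatten bs) →
    ∀ {x y z a b₀ b c₁ c₂ d} →
    flatten bs [ a ]= x → flatten bs [ d ]= x →
    flatten bs [ b₀ ]= y → flatten bs [ b ]= y →
    flatten bs [ c₁ ]= z → flatten bs [ c₂ ]= z →
    b₀ < b → c₁ < c₂ → a < b → b < c₁ → c₁ < d → ⊥
  flatten-¬nested bs perms twice {a = a} {b = b} {c₁ = c₁} {d = d}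
                  ax dx b₀y by c₁z c₂z b₀<b c₁<c₂ a<b b<c₁ c₁<d =
    -- The block around a also contains d, hence b and c₁; b lies in its second half, c₁ in its first.
    let (B , s≤a , a<e) = block-containing bs perms ax
        (_ , _ , d<e)   = occurrences-in-block twice B ax s≤a a<e a<d ax dx
        (_ , m≤b , _)   = occurrences-in-block twice B by (≤-trans s≤a (<⇒≤ a<b))
                            (<-trans b<d d<e) b₀<b b₀y by
        (c₁<m , _ , _)  = occurrences-in-block twice B c₁z (≤-trans s≤a (<⇒≤ a<c₁))
                            (<-trans c₁<d d<e) c₁<c₂ c₁z c₂z
    in <-irrefl refl (<-≤-trans c₁<m (≤-trans m≤b (<⇒≤ b<c₁)))
    where
    a<c₁ : a < c₁
    a<c₁ = <-trans a<b b<c₁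
    b<d : b < d
    b<d = <-trans b<c₁ c₁<d
    a<d : a < d
    a<d = <-trans a<c₁ c₁<d

-- Occurrences and reads

crosses-threshold : ∀ (f : ℕ → ℕ) N {i} → f 0 < i → i ≤ f N →
                    ∃ λ p → p < N × f p < i × i ≤ f (suc p)
crosses-threshold f zero    f0<i i≤f0 = ⊥-elim (<⇒≱ f0<i i≤f0)
crosses-threshold f (suc N) {i} f0<i i≤f[1+N] with i ≤? f N
... | yes i≤fN = let (p , p<N , below) = crosses-threshold f N f0<i i≤fN
                 in p , m<n⇒m<1+n p<N , below
... | no  i≰fN = N , n<1+n N , ≰⇒> i≰fN , i≤f[1+N]

≡ᵇ-sym : ∀ m n → (m ≡ᵇ n) ≡ (n ≡ᵇ m)
≡ᵇ-sym zero    zero    = refl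
≡ᵇ-sym zero    (suc n) = refl
≡ᵇ-sym (suc m) zero    = refl
≡ᵇ-sym (suc m) (suc n) = ≡ᵇ-sym m n

≡ᵇ-or-≡ᵇ : ∀ {m i j} → T ((m ≡ᵇ i) ∨ (m ≡ᵇ j)) → m ≡ i ⊎ m ≡ j
≡ᵇ-or-≡ᵇ {m} {i} {j} h with Equivalence.to (T-∨ {m ≡ᵇ i}) h
... | inj₁ m≡ᵇi = inj₁ (≡ᵇ⇒≡ m i m≡ᵇi)
... | inj₂ m≡ᵇj = inj₂ (≡ᵇ⇒≡ m j m≡ᵇj)

two-values : ∀ {i j m₁ m₂ m₃ : ℕ} → m₁ ≡ i ⊎ m₁ ≡ j → m₂ ≡ i ⊎ m₂ ≡ j → m₃ ≡ i ⊎ m₃ ≡ j →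
             m₁ ≡ m₂ ⊎ m₂ ≡ m₃ ⊎ m₁ ≡ m₃
two-values (inj₁ refl) (inj₁ refl) _           = inj₁ refl
two-values (inj₁ refl) (inj₂ refl) (inj₁ refl) = inj₂ (inj₂ refl)
two-values (inj₁ refl) (inj₂ refl) (inj₂ refl) = inj₂ (inj₁ refl)
two-values (inj₂ refl) (inj₁ refl) (inj₁ refl) = inj₂ (inj₁ refl)
two-values (inj₂ refl) (inj₁ refl) (inj₂ refl) = inj₂ (inj₂ refl)
two-values (inj₂ refl) (inj₂ refl) _           = inj₁ refl

module _ {n : ℕ} where

  ==⇒≡ : {a b : Fin n} → T (a == b) → a ≡ b
  ==⇒≡ {a} {b} a==b = Fin.toℕ-injective (≡ᵇ⇒≡ (toℕ a) (toℕ b) a==b)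

  ≡⇒== : {a b : Fin n} → a ≡ b → T (a == b)
  ≡⇒== {a} refl = ≡⇒≡ᵇ (toℕ a) (toℕ a) refl

  count-∷ : (x y : Fin n) (L : List (Fin n)) →
            count x (y ∷ L) ≡ (if x == y then suc (count x L) else count x L)
  count-∷ x y L rewrite ≡ᵇ-sym (toℕ x) (toℕ y) with y == x
  ... | true  = refl
  ... | false = refl

  annot-at : ∀ {S : List (Fin n)} {p x} → S [ p ]= x → annot S [ p ]= (x , suc (count x (take p S)))
  annot-at here = here
  annot-at {y ∷ S} (there {x = x} {p = p} a) =
    there (subst (λ i → map bump (annot S) [ p ]= (x , i)) (sym count-step) (at-map bump (annot-at a)))
    where
    bump : Fin n × ℕ → Fin n × ℕ
    bump (z , i) = z , (if z == y then suc i else i)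
    count-step : suc (count x (take (suc p) (y ∷ S))) ≡
                 (if x == y then suc (suc (count x (take p S))) else suc (count x (take p S)))
    count-step rewrite count-∷ x y (take p S) with x == y
    ... | true  = refl
    ... | false = refl

  length-annot : ∀ (S : List (Fin n)) → length (annot S) ≡ length S
  length-annot []      = refl
  length-annot (x ∷ S) = cong suc (trans (length-map _ (annot S)) (length-annot S))

  annot-at⁻ : ∀ {S : List (Fin n)} {p u} → annot S [ p ]= u →
              ∃ λ x → S [ p ]= x × u ≡ (x , suc (count x (take p S)))
  annot-at⁻ {S} {p} a =
    let (x , sx) = at-exists S (subst (p <_) (length-annot S) (at-< a))
    in x , sx , at-unique a (annot-at sx)

module Occurrences {n : ℕ} (S : List (Fin n)) where

  countBefore : Fin n → ℕ → ℕ
  countBefore x = rank (_== x) S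

  -- Positions are counted from 0, occurrence numbers from 1.
  Occurrence : Fin n → ℕ → ℕ → Set
  Occurrence x i p = S [ p ]= x × suc (countBefore x p) ≡ i

  countBefore-hit : ∀ {p x} → S [ p ]= x → countBefore x (suc p) ≡ suc (countBefore x p)
  countBefore-hit {x = x} a = rank-hit _ a (≡⇒== {a = x} refl)

  countBefore-miss : ∀ {p x y} → S [ p ]= y → y ≢ x → countBefore x (suc p) ≡ countBefore x p
  countBefore-miss a y≢x = rank-miss _ a (y≢x ∘ ==⇒≡)

  occurs-before : ∀ {x i p q} → Occurrence x i p → i ≤ countBefore x q → p < q
  occurs-before (_ , refl) i≤ = ≰⇒> λ q≤p → 1+n≰n (≤-trans i≤ (rank-mono _ S q≤p))

  occurs-from : ∀ {x i p q} → Occurrence x i p → countBefore x q < i → q ≤ p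
  occurs-from (a , refl) <i =
    ≮⇒≥ λ p<q → 1+n≰n (≤-trans (subst (_≤ _) (countBefore-hit a) (rank-mono _ S p<q)) (≤-pred <i))

  occurrence-unique : ∀ {x i p q} → Occurrence x i p → Occurrence x i q → p ≡ q
  occurrence-unique (a , eᵖ) (b , eᵠ) =
    ≤-antisym (occurs-from (b , eᵠ) (≤-reflexive eᵖ)) (occurs-from (a , eᵖ) (≤-reflexive eᵠ))

  occurrence-order : ∀ {x i j p q} → Occurrence x i p → Occurrence x j q → i < j → p < q
  occurrence-order oᵖ (_ , refl) i<j = occurs-before oᵖ (≤-pred i<j)

  module _ {k : ℕ} (readK : ReadK k S) where

    countBefore-≤ : ∀ x p → countBefore x p ≤ k
    countBefore-≤ x p = subst (_ ≤_) (readK x) (rank-≤ _ S p)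

    occurrence-number-≤ : ∀ {p x} → S [ p ]= x → suc (countBefore x p) ≤ k
    occurrence-number-≤ {p} {x} a = subst (_≤ k) (countBefore-hit a) (countBefore-≤ x (suc p))

    occurrence-exists : ∀ x {i} → 1 ≤ i → i ≤ k → ∃ λ p → Occurrence x i p
    occurrence-exists x {i} 1≤i i≤k
      with crosses-threshold (countBefore x) (length S) 1≤i
             (subst (i ≤_) (sym (trans (cong (count x) (take-all (length S) S ≤-refl)) (readK x))) i≤k)
    ... | p , p<N , below , above with at-exists S p<N
    ... | y , a with y Fin.≟ x
    ...   | yes refl = p , a , ≤-antisym below (subst (i ≤_) (countBefore-hit a) above)
    ...   | no  y≢x  = ⊥-elim (<⇒≱ below (subst (i ≤_) (countBefore-miss a y≢x) above))

  -- readSub i S and readSub2 i j S are definitionally subseq (_≡ᵇ i) and subseq (λ m → (m ≡ᵇ i) ∨ (m ≡ᵇ j)).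
  subseq : (ℕ → Bool) → List (Fin n)
  subseq P = map proj₁ (filterᵇ (P ∘ proj₂) (annot S))

  subseqIndex : (ℕ → Bool) → ℕ → ℕ
  subseqIndex P = rank (P ∘ proj₂) (annot S)

  occurrence⇒annot : ∀ {x i p} → Occurrence x i p → annot S [ p ]= (x , i)
  occurrence⇒annot (a , refl) = annot-at a

  module _ {P : ℕ → Bool} where

    subseq-at : ∀ {x i p} → Occurrence x i p → T (P i) → subseq P [ subseqIndex P p ]= x
    subseq-at o Pi = at-map proj₁ (filter-at _ (occurrence⇒annot o) Pi)

    subseqIndex-strict : ∀ {x i p q} → Occurrence x i p → T (P i) → p < q →
                         subseqIndex P p < subseqIndex P q
    subseqIndex-strict o Pi = rank-strict _ (occurrence⇒annot o) Pi

    subseq-at⁻ : ∀ {a x} → subseq P [ a ]= x →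
                 ∃₂ λ p i → Occurrence x i p × T (P i) × subseqIndex P p ≡ a
    subseq-at⁻ b with at-map⁻ proj₁ b
    ... | u , au , refl with filter-at⁻ _ au
    ... | p , ap , Pu , p↦a with annot-at⁻ {S = S} ap
    ... | x , sx , refl = p , _ , (sx , refl) , Pu , p↦a

    subseq-AtMostTwice :
      (∀ {m₁ m₂ m₃} → T (P m₁) → T (P m₂) → T (P m₃) → m₁ ≡ m₂ ⊎ m₂ ≡ m₃ ⊎ m₁ ≡ m₃) →
      AtMostTwice (subseq P)
    subseq-AtMostTwice twoValues p<q q<r aₚ a_q aᵣ
      with subseq-at⁻ aₚ | subseq-at⁻ a_q | subseq-at⁻ aᵣ
    ... | _ , _ , oₚ , Pₚ , refl | _ , _ , o_q , P_q , refl | _ , _ , oᵣ , Pᵣ , refl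
      with twoValues Pₚ P_q Pᵣ
    ... | inj₁ refl        = <-irrefl (cong (subseqIndex P) (occurrence-unique oₚ o_q)) p<q
    ... | inj₂ (inj₁ refl) = <-irrefl (cong (subseqIndex P) (occurrence-unique o_q oᵣ)) q<r
    ... | inj₂ (inj₂ refl) = <-irrefl (cong (subseqIndex P) (occurrence-unique oₚ oᵣ)) (<-trans p<q q<r)

-- Monotone reads and regularly interleaving pairs of reads

module _ {n : ℕ} where

  SameSide : Fin n → Fin n → Fin n → Set
  SameSide c y z = (c Fin.< y × c Fin.< z) ⊎ (y Fin.< c × z Fin.< c)

  between⇒ : ∀ {c y z : Fin n} → T (between c y z) → (y Fin.< c × c Fin.< z) ⊎ (z Fin.< c × c Fin.< y)
  between⇒ {c} {y} {z} btw with Equivalence.to T-∨ btw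
  ... | inj₁ h = let (y<c , c<z) = Equivalence.to T-∧ h in inj₁ (<ᵇ⇒< _ _ y<c , <ᵇ⇒< _ _ c<z)
  ... | inj₂ h = let (z<c , c<y) = Equivalence.to T-∧ h in inj₂ (<ᵇ⇒< _ _ z<c , <ᵇ⇒< _ _ c<y)

  SameSide⇒¬between : ∀ {c y z : Fin n} → SameSide c y z → ¬ T (between c y z)
  SameSide⇒¬between {c} {y} {z} side btw with side | between⇒ {c} {y} {z} btw
  ... | inj₁ (c<y , _) | inj₁ (y<c , _) = <-asym c<y y<c
  ... | inj₁ (_ , c<z) | inj₂ (z<c , _) = <-asym c<z z<c
  ... | inj₂ (_ , z<c) | inj₁ (_ , c<z) = <-asym c<z z<c
  ... | inj₂ (y<c , _) | inj₂ (_ , c<y) = <-asym c<y y<c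

  ¬between-fromˡ : ∀ {c z : Fin n} → ¬ T (between c c z)
  ¬between-fromˡ {c} {z} btw with between⇒ {c} {c} {z} btw
  ... | inj₁ (c<c , _) = <-irrefl refl c<c
  ... | inj₂ (_ , c<c) = <-irrefl refl c<c

  ¬between-toʳ : ∀ {c y : Fin n} → ¬ T (between c y c)
  ¬between-toʳ {c} {y} btw with between⇒ {c} {y} {c} btw
  ... | inj₁ (_ , c<c) = <-irrefl refl c<c
  ... | inj₂ (c<c , _) = <-irrefl refl c<c

  Monotone : List (Fin n) → Set
  Monotone L = Linked Fin._<_ L ⊎ Linked Fin._>_ L

  Monotone⇒SameSide : ∀ {L c y z a b b′} → Monotone L → L [ a ]= c → L [ b ]= y → L [ b′ ]= z →
                      (a < b × a < b′) ⊎ (b < a × b′ < a) → SameSide c y z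
  Monotone⇒SameSide (inj₁ inc) ac by b′z (inj₁ (a<b , a<b′)) =
    inj₁ (linked-at Fin.<-trans inc ac by a<b , linked-at Fin.<-trans inc ac b′z a<b′)
  Monotone⇒SameSide (inj₁ inc) ac by b′z (inj₂ (b<a , b′<a)) =
    inj₂ (linked-at Fin.<-trans inc by ac b<a , linked-at Fin.<-trans inc b′z ac b′<a)
  Monotone⇒SameSide (inj₂ dec) ac by b′z (inj₁ (a<b , a<b′)) =
    inj₂ (linked-at (flip Fin.<-trans) dec ac by a<b , linked-at (flip Fin.<-trans) dec ac b′z a<b′)
  Monotone⇒SameSide (inj₂ dec) ac by b′z (inj₂ (b<a , b′<a)) =
    inj₁ (linked-at (flip Fin.<-trans) dec by ac b<a , linked-at (flip Fin.<-trans) dec b′z ac b′<a)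

module _ {n : ℕ} {S : List (Fin n)} where
  open Occurrences S

  monotone-read⇒SameSide : ∀ {i c y z a b b′} → Monotone (readSub i S) →
    Occurrence c i a → Occurrence y i b → Occurrence z i b′ →
    (a < b × a < b′) ⊎ (b < a × b′ < a) → SameSide c y z
  monotone-read⇒SameSide {i} {a = a} {b} {b′} mono oc oy oz order =
    Monotone⇒SameSide mono (subseq-at oc i≡ᵇi) (subseq-at oy i≡ᵇi) (subseq-at oz i≡ᵇi) (indices order)
    where
    P : ℕ → Bool
    P m = m ≡ᵇ i
    i≡ᵇi : T (P i)
    i≡ᵇi = ≡⇒≡ᵇ i i refl
    index : ℕ → ℕ
    index = subseqIndex P
    indices : (a < b × a < b′) ⊎ (b < a × b′ < a) →
              (index a < index b × index a < index b′) ⊎ (index b < index a × index b′ < index a)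
    indices (inj₁ (a<b , a<b′)) = inj₁ (subseqIndex-strict oc i≡ᵇi a<b , subseqIndex-strict oc i≡ᵇi a<b′)
    indices (inj₂ (b<a , b′<a)) = inj₂ (subseqIndex-strict oy i≡ᵇi b<a , subseqIndex-strict oz i≡ᵇi b′<a)

  RegInterleaving2⇒¬nested : ∀ {i j} → RegInterleaving2 (readSub2 i j S) →
    ∀ {x y z a b₀ b c₁ c₂ d} → i < j →
    Occurrence x i a → Occurrence x j d → Occurrence y i b₀ → Occurrence y j b →
    Occurrence z i c₁ → Occurrence z j c₂ → a < b → b < c₁ → c₁ < d → ⊥
  RegInterleaving2⇒¬nested {i} {j} (bs , split , blocks) i<j oa od ob₀ ob oc₁ oc₂ a<b b<c₁ c₁<d =
    flatten-¬nested bs (All.map proj₂ blocks) (subst AtMostTwice split twice)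
      (at oa Pi) (at od Pj) (at ob₀ Pi) (at ob Pj) (at oc₁ Pi) (at oc₂ Pj)
      (subseqIndex-strict ob₀ Pi (occurrence-order ob₀ ob i<j))
      (subseqIndex-strict oc₁ Pi (occurrence-order oc₁ oc₂ i<j))
      (subseqIndex-strict oa Pi a<b) (subseqIndex-strict ob Pj b<c₁) (subseqIndex-strict oc₁ Pi c₁<d)
    where
    P : ℕ → Bool
    P m = (m ≡ᵇ i) ∨ (m ≡ᵇ j)
    Pi : T (P i)
    Pi = Equivalence.from T-∨ (inj₁ (≡⇒≡ᵇ i i refl))
    Pj : T (P j)
    Pj = Equivalence.from (T-∨ {j ≡ᵇ i}) (inj₂ (≡⇒≡ᵇ j j refl))
    twice : AtMostTwice (subseq P)
    twice = subseq-AtMostTwice λ Pm₁ Pm₂ Pm₃ →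
      two-values (≡ᵇ-or-≡ᵇ Pm₁) (≡ᵇ-or-≡ᵇ Pm₂) (≡ᵇ-or-≡ᵇ Pm₃)
    at : ∀ {w m p} → Occurrence w m p → T (P m) → flatten bs [ subseqIndex P p ]= w
    at o Pm = subst (_[ _ ]= _) split (subseq-at o Pm)

-- The phase potential

phase : ℕ → ℕ → ℕ
phase r ι with r <? ι
... | yes _ = suc r
... | no  _ = r

phase-of-< : ∀ {r ι} → r < ι → phase r ι ≡ suc r
phase-of-< {r} {ι} r<ι with r <? ι
... | yes _   = refl
... | no  r≮ι = contradiction r<ι r≮ι

phase-of-≥ : ∀ {r ι} → ι ≤ r → phase r ι ≡ r
phase-of-≥ {r} {ι} ι≤r with r <? ι
... | yes r<ι = contradiction ι≤r (<⇒≱ r<ι)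
... | no  _   = refl

r≤phase : ∀ r ι → r ≤ phase r ι
r≤phase r ι with r <? ι
... | yes _ = n≤1+n r
... | no  _ = ≤-refl

phase≤1+r : ∀ r ι → phase r ι ≤ suc r
phase≤1+r r ι with r <? ι
... | yes _ = ≤-refl
... | no  _ = n≤1+n r

phase-≤ : ∀ {r ι k} → r ≤ k → ι ≤ k → phase r ι ≤ k
phase-≤ {r} {ι} r≤k ι≤k with r <? ι
... | yes r<ι = ≤-trans r<ι ι≤k
... | no  _   = r≤k

+-indicator-≤ : ∀ {m n} (b : Bool) → (T b → m < n) → m ≤ n → m + (if b then 1 else 0) ≤ n
+-indicator-≤ {m} {n} true  strict _    = subst (_≤ n) (+-comm 1 m) (strict _)
+-indicator-≤ {m} {n} false _      mono = subst (_≤ n) (sym (+-identityʳ m)) mono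

module _ {n : ℕ} (c : Fin n) where

  crossing : Fin n → Fin n → ℕ
  crossing y z = if between c y z then 1 else 0

  passes+potential-≤ : ∀ {m} x L (Φ : Fin n → ℕ → ℕ) →
    (∀ {p y z} → (x ∷ L) [ p ]= y → (x ∷ L) [ suc p ]= z → Φ y p + crossing y z ≤ Φ z (suc p)) →
    (∀ {p y} → (x ∷ L) [ p ]= y → Φ y p ≤ m) →
    passes c (x ∷ L) + Φ x 0 ≤ m
  passes+potential-≤ x []      Φ step bound = bound here
  passes+potential-≤ {m} x (y ∷ L) Φ step bound = begin
    (crossing x y + passes c (y ∷ L)) + Φ x 0  ≡⟨ +-assoc (crossing x y) _ _ ⟩
    crossing x y + (passes c (y ∷ L) + Φ x 0)  ≡⟨ +-comm (crossing x y) _ ⟩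
    (passes c (y ∷ L) + Φ x 0) + crossing x y  ≡⟨ +-assoc (passes c (y ∷ L)) _ _ ⟩
    passes c (y ∷ L) + (Φ x 0 + crossing x y)  ≤⟨ +-monoʳ-≤ (passes c (y ∷ L)) (step here (there here)) ⟩
    passes c (y ∷ L) + Φ y 1                   ≤⟨ passes+potential-≤ y L (λ z p → Φ z (suc p))
                                                    (λ a b → step (there a) (there b)) (bound ∘ there) ⟩
    m                                          ∎
    where open ≤-Reasoning

  passes-≤ : ∀ {m} L (Φ : Fin n → ℕ → ℕ) →
    (∀ {p y z} → L [ p ]= y → L [ suc p ]= z → Φ y p + crossing y z ≤ Φ z (suc p)) →
    (∀ {p y} → L [ p ]= y → Φ y p ≤ m) →
    passes c L ≤ m
  passes-≤ []      Φ step bound = z≤n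
  passes-≤ (x ∷ L) Φ step bound = ≤-trans (m≤m+n _ _) (passes+potential-≤ x L Φ step bound)

module HeadVisits {n k : ℕ} {S : List (Fin n)} (readK : ReadK k S)
                  (monotone : PerReadMonotone k S) (interleaving : RegInterleavingK k S)
                  (c : Fin n) where
  open Occurrences S

  potential : Fin n → ℕ → ℕ
  potential x p = phase (countBefore c (suc p)) (suc (countBefore x p))

  potential-≤ : ∀ {p x} → S [ p ]= x → potential x p ≤ k
  potential-≤ {p} a = phase-≤ (countBefore-≤ readK c (suc p)) (occurrence-number-≤ readK a)

  module Step {p y z} (sy : S [ p ]= y) (sz : S [ suc p ]= z) (y≢c : y ≢ c) (z≢c : z ≢ c) where

    r ιy ιz : ℕ
    r  = countBefore c (suc p)
    ιy = suc (countBefore y p)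
    ιz = suc (countBefore z (suc p))

    r-before : countBefore c p ≡ r
    r-before = sym (countBefore-miss sy y≢c)

    r-after : countBefore c (suc (suc p)) ≡ r
    r-after = countBefore-miss sz z≢c

    r≤k : r ≤ k
    r≤k = countBefore-≤ readK c (suc p)

    ιy≤k : ιy ≤ k
    ιy≤k = occurrence-number-≤ readK sy

    ιz≤k : ιz ≤ k
    ιz≤k = occurrence-number-≤ readK sz

    -- c is read for the ιz-th time before p and for the ιy-th time after p + 1.
    no-descent : ιz ≤ r → r < ιy → ⊥
    no-descent ιz≤r r<ιy =
      let (a  , oa)  = occurrence-exists readK c (s≤s z≤n) ιz≤k
          (d  , od)  = occurrence-exists readK c (s≤s z≤n) ιy≤k
          (b₀ , ob₀) = occurrence-exists readK y (s≤s z≤n) ιz≤k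
          (c₂ , oc₂) = occurrence-exists readK z (s≤s z≤n) ιy≤k
      in RegInterleaving2⇒¬nested
           (interleaving ιz ιy (s≤s z≤n) ιz≤k (s≤s z≤n) ιy≤k (<⇒≢ ιz<ιy)) ιz<ιy
           oa od ob₀ (sy , refl) (sz , refl) oc₂
           (occurs-before oa (subst (ιz ≤_) (sym r-before) ιz≤r))
           (n<1+n p)
           (occurs-from od (subst (_< ιy) (sym r-after) r<ιy))
      where
      ιz<ιy : ιz < ιy
      ιz<ιy = ≤-<-trans ιz≤r r<ιy

    behind⇒SameSide : ιy ≤ r → ιz ≤ r → SameSide c y z
    behind⇒SameSide ιy≤r ιz≤r =
      let (a  , oa)  = occurrence-exists readK c 1≤r r≤k
          (b  , ob)  = occurrence-exists readK y 1≤r r≤k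
          (b′ , ob′) = occurrence-exists readK z 1≤r r≤k
          a<p        = occurs-before oa (≤-reflexive (sym r-before))
      in monotone-read⇒SameSide (monotone r 1≤r r≤k) oa ob ob′
           (inj₁ (<-≤-trans a<p (occurs-from ob ιy≤r) , <-trans a<p (occurs-from ob′ ιz≤r)))
      where
      1≤r : 1 ≤ r
      1≤r = ≤-trans (s≤s z≤n) ιy≤r

    ahead⇒SameSide : r < ιy → r < ιz → SameSide c y z
    ahead⇒SameSide r<ιy r<ιz =
      let (a  , oa)  = occurrence-exists readK c (s≤s z≤n) r<k
          (b  , ob)  = occurrence-exists readK y (s≤s z≤n) r<k
          (b′ , ob′) = occurrence-exists readK z (s≤s z≤n) r<k
          2+p≤a      = occurs-from oa (s≤s (≤-reflexive r-after))
      in monotone-read⇒SameSide (monotone (suc r) (s≤s z≤n) r<k) oa ob ob′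
           (inj₂ (<-trans (occurs-before ob (subst (suc r ≤_) (sym (countBefore-hit sy)) r<ιy)) 2+p≤a ,
                  <-≤-trans (occurs-before ob′ (subst (suc r ≤_) (sym (countBefore-hit sz)) r<ιz)) 2+p≤a))
      where
      r<k : r < k
      r<k = <-≤-trans r<ιy ιy≤k

    potential-step : potential y p + crossing c y z ≤ potential z (suc p)
    potential-step rewrite r-after = +-indicator-≤ (between c y z) strict mono
      where
      mono : phase r ιy ≤ phase r ιz
      mono with <-≤-connex r ιy | <-≤-connex r ιz
      ... | inj₁ r<ιy | inj₁ r<ιz = ≤-reflexive (trans (phase-of-< r<ιy) (sym (phase-of-< r<ιz)))
      ... | inj₁ r<ιy | inj₂ ιz≤r = ⊥-elim (no-descent ιz≤r r<ιy)
      ... | inj₂ ιy≤r | _         = subst (_≤ phase r ιz) (sym (phase-of-≥ ιy≤r)) (r≤phase r ιz)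
      strict : T (between c y z) → phase r ιy < phase r ιz
      strict btw with <-≤-connex r ιy | <-≤-connex r ιz
      ... | inj₁ r<ιy | inj₁ r<ιz = ⊥-elim (SameSide⇒¬between (ahead⇒SameSide r<ιy r<ιz) btw)
      ... | inj₁ r<ιy | inj₂ ιz≤r = ⊥-elim (no-descent ιz≤r r<ιy)
      ... | inj₂ ιy≤r | inj₁ r<ιz = subst₂ _<_ (sym (phase-of-≥ ιy≤r)) (sym (phase-of-< r<ιz)) (n<1+n r)
      ... | inj₂ ιy≤r | inj₂ ιz≤r = ⊥-elim (SameSide⇒¬between (behind⇒SameSide ιy≤r ιz≤r) btw)

  potential-step : ∀ {p y z} → S [ p ]= y → S [ suc p ]= z →
                   potential y p + crossing c y z ≤ potential z (suc p)
  potential-step {p} {y} {z} sy sz with y Fin.≟ c | z Fin.≟ c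
  ... | _        | yes refl =
    +-indicator-≤ (between c y c) (⊥-elim ∘ ¬between-toʳ {c = c} {y = y}) (begin
    potential y p                   ≤⟨ phase≤1+r R _ ⟩
    suc R                           ≡⟨ sym (phase-of-≥ ≤-refl) ⟩
    phase (suc R) (suc R)           ≡⟨ cong (λ r → phase r (suc R)) (sym (countBefore-hit sz)) ⟩
    potential c (suc p)             ∎)
    where
    open ≤-Reasoning
    R : ℕ
    R = countBefore c (suc p)
  ... | yes refl | no  z≢c  =
    +-indicator-≤ (between c c z) (⊥-elim ∘ ¬between-fromˡ {c = c} {z = z}) (begin
    potential c p                   ≡⟨ cong (phase R) (sym (countBefore-hit sy)) ⟩
    phase R R                       ≡⟨ phase-of-≥ ≤-refl ⟩
    R                               ≡⟨ sym (countBefore-miss sz z≢c) ⟩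
    countBefore c (suc (suc p))     ≤⟨ r≤phase _ _ ⟩
    potential z (suc p)             ∎)
    where
    open ≤-Reasoning
    R : ℕ
    R = countBefore c (suc p)
  ... | no  y≢c  | no  z≢c  = Step.potential-step sy sz y≢c z≢c

lemma3p2 : (n k : ℕ) (S : List (Fin n)) →
    ReadK k S → IndexedByFirstRead S → PerReadMonotone k S → RegInterleavingK k S →
    (c : Fin n) → visits c S ≤ 2 * k
lemma3p2 n k S readK _ monotone interleaving c = begin
  count c S + passes c S  ≡⟨ cong (_+ passes c S) (readK c) ⟩
  k + passes c S          ≤⟨ +-monoʳ-≤ k (passes-≤ c S potential potential-step potential-≤) ⟩
  k + k                   ≡⟨ cong (k +_) (sym (+-identityʳ k)) ⟩
  2 * k                   ∎
  where
  open HeadVisits {S = S} readK monotone interleaving c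
  open ≤-Reasoning
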